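{- Let $\mathcal U$ be an absolute universe and let $G\in\mathcal U$. Suppose $A$ is a Left option of $G$ and $B$ is a Right option of $A$ such that $B\leq_{\mathcal U}G$ and $B$ has at least one Left option (i.e. $A$ is open-reversible through $B$, with replacement set $B^{\mathcal L}$). Then $$G\equiv_{\mathcal U}\{(G^{\mathcal L}\setminus\{A\})\cup B^{\mathcal L}\mid G^{\mathcal R}\}.$$
   Context: All games are short two-player partizan games between Left and Right, identified with their game trees: $G=\{G^{\mathcal L}\mid G^{\mathcal R}\}$ with finite sets of options; $\mathcal M$ is the class of all such games. Disjunctive sum: $G+H=\{G^{\mathcal L}+H,G+H^{\mathcal L}\mid G^{\mathcal R}+H,G+H^{\mathcal R}\}$. Conjugate: $\overline G=\{\overline{G^{\mathcal R}}\mid\overline{G^{\mathcal L}}\}$. Misère play: a player with no move on their turn wins. $o_L(G)=\mathrm L$ if $G^{\mathcal L}=\emptyset$, else $\max_{G^L}o_R(G^L)$; $o_R(G)=\mathrm R$ if $G^{\mathcal R}=\emptyset$, else $\min_{G^R}o_L(G^R)$; $\mathrm L>\mathrm R$. The outcome $o(G)$ is the pair $(o_L(G),o_R(G))$ (four possible outcomes), ordered componentwise. A universe is a nonempty class $\mathcal U\subseteq\mathcal M$ closed under taking options, disjunctive sums and conjugates. For $G,H\in\mathcal M$, $G\geq_{\mathcal U}H$ means $o(G+X)\geq o(H+X)$ for all $X\in\mathcal U$; $G\equiv_{\mathcal U}H$ means $G\geq_{\mathcal U}H$ and $H\geq_{\mathcal U}G$. A universe is parental if $\{S\mid T\}\in\mathcal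 U$ for all non-empty finite $S,T\subseteq\mathcal U$; dense if for every outcome $x$ and every $G\in\mathcal U$ there is $H\in\mathcal U$ with $o(G+H)=x$; absolute if it is parental and dense. -}

module Defs where

open import Data.Nat using (ℕ; zero; suc; _+_)
open import Data.Fin using (Fin; splitAt)
open import Data.Bool using (Bool; true; false; _∨_; _∧_)
open import Data.Sum using (_⊎_; inj₁; inj₂; [_,_])
open import Data.Product using (Σ; ∃; _×_; _,_)
open import Relation.Binary.PropositionalEquality using (_≡_)
open import Relation.Nullary using (¬_)

data Game : Set where
  game : (m : ℕ) → (Fin m → Game) → (n : ℕ) → (Fin n → Game) → Game

nL : Game → ℕ
nL (game m _ _ _) = m

nR : Game → ℕ
nR (game _ _ n _) = n

GL : (G : Game) → Fin (nL G) → Game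
GL (game _ f _ _) = f

GR : (G : Game) → Fin (nR G) → Game
GR (game _ _ _ g) = g

-- Identity of game trees (option *sets* compared extensionally).
data _≅_ : Game → Game → Set where
  iso : ∀ {m f n g m' f' n' g'} →
        (∀ i → ∃ λ i' → f i ≅ f' i') →
        (∀ i' → ∃ λ i → f i ≅ f' i') →
        (∀ j → ∃ λ j' → g j ≅ g' j') →
        (∀ j' → ∃ λ j → g j ≅ g' j') →
        game m f n g ≅ game m' f' n' g'

infixl 6 _⊕_
_⊕_ : Game → Game → Game
game m f n g ⊕ game m' f' n' g' =
  game (m + m') (λ i → [ (λ a → f a ⊕ game m' f' n' g') , (λ b → game m f n g ⊕ f' b) ] (splitAt m i))
       (n + n') (λ i → [ (λ a → g a ⊕ game m' f' n' g') , (λ b → game m f n g ⊕ g' b) ] (splitAt n i))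

conj : Game → Game
conj (game m f n g) = game n (λ j → conj (g j)) m (λ i → conj (f i))

anyFin : (n : ℕ) → (Fin n → Bool) → Bool
anyFin zero _ = false
anyFin (suc n) p = p Fin.zero ∨ anyFin n (λ i → p (Fin.suc i))

allFin : (n : ℕ) → (Fin n → Bool) → Bool
allFin zero _ = true
allFin (suc n) p = p Fin.zero ∧ allFin n (λ i → p (Fin.suc i))

-- Misère outcomes. Encoding: true = L, false = R (so L > R is true > false).
mutual
  oL : Game → Bool
  oL (game zero _ _ _) = true
  oL (game (suc m) f _ _) = anyFin (suc m) (λ i → oR (f i))

  oR : Game → Bool
  oR (game _ _ zero _) = false
  oR (game _ _ (suc n) g) = allFin (suc n) (λ j → oL (g j))

Outcome : Set
Outcome = Bool × Bool

o : Game → Outcome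
o G = oL G , oR G

_≥b_ : Bool → Bool → Set
b ≥b b' = b' ≡ true → b ≡ true

_≥o_ : Outcome → Outcome → Set
(a , b) ≥o (a' , b') = (a ≥b a') × (b ≥b b')

-- Universes (classes of game trees, hence closed under tree identity ≅)
record Universe (U : Game → Set) : Set where
  field
    nonempty   : ∃ λ G → U G
    respects≅  : ∀ {G H} → G ≅ H → U G → U H
    closedL    : ∀ G → U G → ∀ i → U (GL G i)
    closedR    : ∀ G → U G → ∀ j → U (GR G j)
    closed⊕    : ∀ G H → U G → U H → U (G ⊕ H)
    closedConj : ∀ G → U G → U (conj G)

Parental : (Game → Set) → Set
Parental U = ∀ m n (f : Fin (suc m) → Game) (g : Fin (suc n) → Game) →
  (∀ i → U (f i)) → (∀ j → U (g j)) → U (game (suc m) f (suc n) g)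

Dense : (Game → Set) → Set
Dense U = ∀ (x : Outcome) G → U G → ∃ λ H → U H × (o (G ⊕ H) ≡ x)

Absolute : (Game → Set) → Set
Absolute U = Universe U × Parental U × Dense U

_≥[_]_ : Game → (Game → Set) → Game → Set
G ≥[ U ] H = ∀ X → U X → o (G ⊕ X) ≥o o (H ⊕ X)

_≡[_]_ : Game → (Game → Set) → Game → Set
G ≡[ U ] H = (G ≥[ U ] H) × (H ≥[ U ] G)

-- G' has Left option set (G^L \ {A}) ∪ S^L (as sets of game trees, A removed
-- with all identical copies) and exactly the Right options of G.
IsReversal : (G A S G' : Game) → Set
IsReversal G A S G' =
  ((∀ k → (∃ λ i → (GL G' k ≅ GL G i) × ¬ (GL G i ≅ A)) ⊎ (∃ λ l → GL G' k ≅ GL S l))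
  × (∀ i → ¬ (GL G i ≅ A) → ∃ λ k → GL G' k ≅ GL G i)
  × (∀ l → ∃ λ k → GL G' k ≅ GL S l))
  × ((∀ k → ∃ λ j → GR G' k ≅ GR G j) × (∀ j → ∃ λ k → GR G' k ≅ GR G j))

module Submission where

-- We show o(G + X) = o(G' + X) for
-- every X in U by induction on X, comparing the two components of the
-- outcome (Left wins moving first / moving second) separately:
--  * a Left move of G' to some B^L wins because it shows that Left wins B + X
--    moving first, hence (B ≤ G) also G + X;
--  * a winning Left move of G to A is answered by Right moving to B; Left's
--    winning reply in B + X is either a move to some B^L, available in G', or
--    a move in X, which transfers to G + X^L by B ≤ G and to G' + X^L by
--    induction;
--  * Right options are the same on both sides, and moves in X use induction.
-- The only property of U that is needed is closure under options.

open import Defs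
open import Data.Nat using (_<_; zero; suc)
open import Data.Fin using (Fin; splitAt; join; fromℕ<; _↑ˡ_; _↑ʳ_)
open import Data.Fin.Properties using (splitAt-↑ˡ; splitAt-↑ʳ; splitAt-join)
open import Data.Bool using (Bool; true; false)
open import Data.Bool.Properties using (_≟_; ∨-zeroʳ)
open import Data.Sum using (_⊎_; inj₁; inj₂; [_,_])
import Data.Sum as Sum
open import Data.Product using (∃; _×_; _,_; proj₁; proj₂)
open import Function using (_∘_; flip)
open import Relation.Nullary using (¬_; yes; no)
open import Relation.Nullary.Decidable using (decidable-stable; ¬¬-excluded-middle)
open import Relation.Binary.PropositionalEquality using (_≡_; refl; sym; cong; subst)

LeftWinsFirst : Game → Set
LeftWinsFirst G = oL G ≡ true

LeftWinsSecond : Game → Set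
LeftWinsSecond G = oR G ≡ true

-- A claim b ≡ true is decidable, hence stable under double negation, so it
-- may be proved by a classical case split on an arbitrary proposition P.
byCases : ∀ {P : Set} (b : Bool) → (P → b ≡ true) → (¬ P → b ≡ true) → b ≡ true
byCases b ifP ifNotP = decidable-stable (b ≟ true) λ b≢true →
  ¬¬-excluded-middle λ { (yes p) → b≢true (ifP p) ; (no ¬p) → b≢true (ifNotP ¬p) }

anyFin-intro : ∀ n (p : Fin n → Bool) i → p i ≡ true → anyFin n p ≡ true
anyFin-intro (suc n) p Fin.zero pi rewrite pi = refl
anyFin-intro (suc n) p (Fin.suc i) pi
  rewrite anyFin-intro n (p ∘ Fin.suc) i pi = ∨-zeroʳ (p Fin.zero)

anyFin-elim : ∀ n (p : Fin n → Bool) → anyFin n p ≡ true → ∃ λ i → p i ≡ true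
anyFin-elim (suc n) p any with p Fin.zero in p0
... | true  = Fin.zero , p0
... | false = let i , pi = anyFin-elim n (p ∘ Fin.suc) any in Fin.suc i , pi

allFin-intro : ∀ n (p : Fin n → Bool) → (∀ i → p i ≡ true) → allFin n p ≡ true
allFin-intro zero    p all = refl
allFin-intro (suc n) p all rewrite all Fin.zero = allFin-intro n (p ∘ Fin.suc) (all ∘ Fin.suc)

allFin-elim : ∀ n (p : Fin n → Bool) → allFin n p ≡ true → ∀ i → p i ≡ true
allFin-elim (suc n) p all i with p Fin.zero in p0
allFin-elim (suc n) p all Fin.zero    | true = p0
allFin-elim (suc n) p all (Fin.suc i) | true = allFin-elim n (p ∘ Fin.suc) all i

firstWin-intro : ∀ H k → LeftWinsSecond (GL H k) → LeftWinsFirst H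
firstWin-intro (game (suc m) f n g) = anyFin-intro (suc m) (oR ∘ f)

firstWin-elim : ∀ H → Fin (nL H) → LeftWinsFirst H → ∃ λ k → LeftWinsSecond (GL H k)
firstWin-elim (game (suc m) f n g) _ = anyFin-elim (suc m) (oR ∘ f)

secondWin-intro : ∀ H → Fin (nR H) → (∀ k → LeftWinsFirst (GR H k)) → LeftWinsSecond H
secondWin-intro (game m f (suc n) g) _ = allFin-intro (suc n) (oL ∘ g)

secondWin-elim : ∀ H → LeftWinsSecond H → Fin (nR H) × (∀ k → LeftWinsFirst (GR H k))
secondWin-elim (game m f (suc n) g) win = Fin.zero , allFin-elim (suc n) (oL ∘ g) win

firstWin-transfer : ∀ G H → (Fin (nL H) → Fin (nL G)) →
  (∀ k → ∃ λ k' → LeftWinsSecond (GL G k) → LeftWinsSecond (GL H k')) →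
  LeftWinsFirst G → LeftWinsFirst H
firstWin-transfer G (game zero    f n g) _    _     _   = refl
firstWin-transfer G H@(game (suc m) f n g) back match win =
  let k , wk = firstWin-elim G (back Fin.zero) win
      k' , imp = match k
  in firstWin-intro H k' (imp wk)

secondWin-transfer : ∀ G H → (Fin (nR G) → Fin (nR H)) →
  (∀ k' → ∃ λ k → LeftWinsFirst (GR G k) → LeftWinsFirst (GR H k')) →
  LeftWinsSecond G → LeftWinsSecond H
secondWin-transfer G H forth match win =
  let k₀ , all = secondWin-elim G win
  in secondWin-intro H (forth k₀) λ k' → let k , imp = match k' in imp (all k)

join-match : ∀ (R : Game → Game → Set) {m m' p}
  {F : Fin m → Game} {F' : Fin m' → Game} {K K' : Fin p → Game} →
  (∀ a → ∃ λ a' → R (F a) (F' a')) → (∀ b → R (K b) (K' b)) →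
  ∀ k → ∃ λ k' → R ([ F , K ] (splitAt m k)) ([ F' , K' ] (splitAt m' k'))
join-match R {m} {m'} {p} {F} {F'} {K} {K'} matchF matchK k with splitAt m k
... | inj₁ a = let a' , r = matchF a in
  join m' p (inj₁ a') , subst (R (F a)) (cong [ F' , K' ] (sym (splitAt-join m' p (inj₁ a')))) r
... | inj₂ b =
  join m' p (inj₂ b) , subst (R (K b)) (cong [ F' , K' ] (sym (splitAt-join m' p (inj₂ b)))) (matchK b)

moveLeft-inGame : ∀ G X i → LeftWinsSecond (GL G i ⊕ X) → LeftWinsFirst (G ⊕ X)
moveLeft-inGame G@(game m f n g) X@(game p h q r) i win =
  firstWin-intro (G ⊕ X) (i ↑ˡ p) (subst LeftWinsSecond (cong ([_,_] _ _) (sym (splitAt-↑ˡ m i p))) win)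

moveLeft-inContext : ∀ G X b → LeftWinsSecond (G ⊕ GL X b) → LeftWinsFirst (G ⊕ X)
moveLeft-inContext G@(game m f n g) X@(game p h q r) b win =
  firstWin-intro (G ⊕ X) (m ↑ʳ b) (subst LeftWinsSecond (cong ([_,_] _ _) (sym (splitAt-↑ʳ m p b))) win)

firstWin-sum-elim : ∀ G X → Fin (nL G) → LeftWinsFirst (G ⊕ X) →
  (∃ λ i → LeftWinsSecond (GL G i ⊕ X)) ⊎ (∃ λ b → LeftWinsSecond (G ⊕ GL X b))
firstWin-sum-elim G@(game m f n g) X@(game p h q r) i win
  with firstWin-elim (G ⊕ X) (i ↑ˡ p) win
... | k , wk with splitAt m k
...   | inj₁ a = inj₁ (a , wk)
...   | inj₂ b = inj₂ (b , wk)

≅-sym : ∀ {G H} → G ≅ H → H ≅ G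
≅-sym (iso φ ψ χ ω) =
  iso (λ i' → let i , e = ψ i' in i , ≅-sym e) (λ i → let i' , e = φ i in i' , ≅-sym e)
      (λ j' → let j , e = ω j' in j , ≅-sym e) (λ j → let j' , e = χ j in j' , ≅-sym e)

≅-⊕ : ∀ {G H} X → G ≅ H → (G ⊕ X) ≅ (H ⊕ X)
≅-⊕ {game m f n g} {game m' f' n' g'} X@(game p h q r) G≅H@(iso φ ψ χ ω) =
  iso (join-match _≅_ (λ a → let a' , e = φ a in a' , ≅-⊕ X e) (λ b → ≅-⊕ (h b) G≅H))
      (join-match (flip _≅_) (λ a' → let a , e = ψ a' in a , ≅-⊕ X e) (λ b → ≅-⊕ (h b) G≅H))
      (join-match _≅_ (λ a → let a' , e = χ a in a' , ≅-⊕ X e) (λ b → ≅-⊕ (r b) G≅H))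
      (join-match (flip _≅_) (λ a' → let a , e = ω a' in a , ≅-⊕ X e) (λ b → ≅-⊕ (r b) G≅H))

≅-outcome : ∀ {G H} → G ≅ H → o H ≥o o G
≅-outcome {G@(game m f n g)} {H@(game m' f' n' g')} (iso φ ψ χ ω) =
  firstWin-transfer G H (proj₁ ∘ ψ) (λ k → let k' , e = φ k in k' , proj₂ (≅-outcome e)) ,
  secondWin-transfer G H (proj₁ ∘ χ) (λ k' → let k , e = ω k' in k , proj₁ (≅-outcome e))

≅-ctx : ∀ {G H} → G ≅ H → ∀ X → o (G ⊕ X) ≥o o (H ⊕ X)
≅-ctx G≅H X = ≅-outcome (≅-⊕ X (≅-sym G≅H))

secondWin-inGame : ∀ G X j → LeftWinsSecond (G ⊕ X) → LeftWinsFirst (GR G j ⊕ X)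
secondWin-inGame G@(game m f n g) X@(game p h q r) j win =
  subst LeftWinsFirst (cong ([_,_] _ _) (splitAt-↑ˡ n j q)) (proj₂ (secondWin-elim (G ⊕ X) win) (j ↑ˡ q))

secondWin-sum-transfer : ∀ P Q X → (Fin (nR P) → Fin (nR Q)) →
  (∀ k → ∃ λ j → GR Q k ≅ GR P j) →
  (∀ b → LeftWinsFirst (P ⊕ GR X b) → LeftWinsFirst (Q ⊕ GR X b)) →
  LeftWinsSecond (P ⊕ X) → LeftWinsSecond (Q ⊕ X)
secondWin-sum-transfer P@(game m f n g) Q@(game m' f' n' g') X@(game p h q r) forth match ctx =
  secondWin-transfer (P ⊕ X) (Q ⊕ X) (join n' q ∘ Sum.map₁ forth ∘ splitAt n)
    (join-match WorseForLeft (λ k → let j , e = match k in j , proj₁ (≅-ctx e X)) ctx)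
  where
  WorseForLeft : Game → Game → Set
  WorseForLeft Y Z = LeftWinsFirst Z → LeftWinsFirst Y

module Reversal (U : Game → Set)
    (closedL : ∀ X → U X → ∀ b → U (GL X b))
    (closedR : ∀ X → U X → ∀ b → U (GR X b))
    (G : Game) (i : Fin (nL G)) (j : Fin (nR (GL G i)))
    (B≤G : G ≥[ U ] GR (GL G i) j) (l : Fin (nL (GR (GL G i) j))) (G' : Game)
    (fromL : ∀ k → (∃ λ i' → (GL G' k ≅ GL G i') × ¬ (GL G i' ≅ GL G i))
                 ⊎ (∃ λ l' → GL G' k ≅ GL (GR (GL G i) j) l'))
    (keepL : ∀ i' → ¬ (GL G i' ≅ GL G i) → ∃ λ k → GL G' k ≅ GL G i')
    (addL : ∀ l' → ∃ λ k → GL G' k ≅ GL (GR (GL G i) j) l')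
    (rightTo : ∀ k → ∃ λ j' → GR G' k ≅ GR G j')
    (rightFrom : ∀ j' → ∃ λ k → GR G' k ≅ GR G j') where

  A : Game
  A = GL G i

  B : Game
  B = GR A j

  -- A winning move to A is answered by Right moving to B; Left's winning
  -- reply in B + X is either a move to some B^L, which G' offers directly,
  -- or a move to B + X^L, so that G + X^L and (inductively) G' + X^L win.
  answerA : ∀ X → U X →
    (∀ b → LeftWinsSecond (G ⊕ GL X b) → LeftWinsSecond (G' ⊕ GL X b)) →
    LeftWinsSecond (A ⊕ X) → LeftWinsFirst (G' ⊕ X)
  answerA X uX ih win with firstWin-sum-elim B X l (secondWin-inGame A X j win)
  ... | inj₁ (l' , w) = let k , e = addL l' in moveLeft-inGame G' X k (proj₂ (≅-ctx e X) w)
  ... | inj₂ (b , w) = let uXb = closedL X uX b in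
    moveLeft-inContext G' X b (ih b (proj₂ (B≤G (GL X b) uXb) w))

  -- G' ≥ G, by induction on X.  A winning Left move of G to an option other
  -- than A is still available in G'; a winning move to A is handled by answerA.
  mutual
    G'-first : ∀ X → U X → LeftWinsFirst (G ⊕ X) → LeftWinsFirst (G' ⊕ X)
    G'-first X@(game _ h _ _) uX win with firstWin-sum-elim G X i win
    ... | inj₂ (b , w) = moveLeft-inContext G' X b (G'-second (h b) (closedL X uX b) w)
    ... | inj₁ (i' , w) = byCases (oL (G' ⊕ X))
      (λ i'≅A → answerA X uX (λ b → G'-second (h b) (closedL X uX b))
                        (proj₂ (≅-ctx (≅-sym i'≅A) X) w))
      (λ i'≇A → let k , e = keepL i' i'≇A in moveLeft-inGame G' X k (proj₂ (≅-ctx e X) w))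

    G'-second : ∀ X → U X → LeftWinsSecond (G ⊕ X) → LeftWinsSecond (G' ⊕ X)
    G'-second X@(game _ _ _ r) uX = secondWin-sum-transfer G G' X (proj₁ ∘ rightFrom) rightTo
      (λ b → G'-first (r b) (closedR X uX b))

  G'≥G : G' ≥[ U ] G
  G'≥G X uX = G'-first X uX , G'-second X uX

  mutual
    -- A move of G' to some B^L wins for Left in B + X, hence in G + X.
    G-first : ∀ X → U X → LeftWinsFirst (G' ⊕ X) → LeftWinsFirst (G ⊕ X)
    G-first X@(game _ h _ _) uX win with firstWin-sum-elim G' X (proj₁ (addL l)) win
    ... | inj₂ (b , w) = moveLeft-inContext G X b (G-second (h b) (closedL X uX b) w)
    ... | inj₁ (k , w) with fromL k
    ...   | inj₁ (i' , e , _) = moveLeft-inGame G X i' (proj₂ (≅-ctx (≅-sym e) X) w)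
    ...   | inj₂ (l' , e) = proj₁ (B≤G X uX) (moveLeft-inGame B X l' (proj₂ (≅-ctx (≅-sym e) X) w))

    G-second : ∀ X → U X → LeftWinsSecond (G' ⊕ X) → LeftWinsSecond (G ⊕ X)
    G-second X@(game _ _ _ r) uX = secondWin-sum-transfer G' G X (proj₁ ∘ rightTo)
      (λ j' → let k , e = rightFrom j' in k , ≅-sym e)
      (λ b → G-first (r b) (closedR X uX b))

  G≥G' : G ≥[ U ] G'
  G≥G' X uX = G-first X uX , G-second X uX

mainTheorem6 : (U : Game → Set) → Absolute U →
    (G : Game) → U G →
    (i : Fin (nL G)) → (j : Fin (nR (GL G i))) →
    G ≥[ U ] GR (GL G i) j → 0 < nL (GR (GL G i) j) →
    (G' : Game) → IsReversal G (GL G i) (GR (GL G i) j) G' →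
    G ≡[ U ] G'
mainTheorem6 U (universe , _) G _ i j B≤G B-hasLeft G'
             ((fromL , keepL , addL) , (rightTo , rightFrom)) = G≥G' , G'≥G
  where
  open Universe universe using (closedL; closedR)
  open Reversal U closedL closedR G i j B≤G (fromℕ< B-hasLeft) G' fromL keepL addL rightTo rightFrom
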